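{- For almost all graphs $G$, no three vertices can be encoded by the same letter in a lettering of $G$. That is, letting $G = G(n,\tfrac12)$, the probability that there exist a word $w$ and a decoder $D$ with $\Gamma_D(w) \cong G$ such that some letter occurs at least three times in $w$ tends to $0$ as $n \to \infty$.
   Context: For a finite alphabet $\Sigma$, a decoder is a set $D \subseteq \Sigma^2$ of ordered pairs. For a word $w = w(1)\cdots w(n)$ with letters in $\Sigma$, the letter graph $\Gamma_D(w)$ is the graph with vertex set $\{1,\dots,n\}$ and an edge between $i<j$ exactly when $(w(i),w(j)) \in D$. A word $w$ is a lettering of a graph $G$ if $\Gamma_D(w) \cong G$ for some decoder $D$; a letter $a$ encodes the vertices corresponding to its occurrences in $w$. $G(n,\tfrac12)$ is the random graph on $n$ labeled vertices in which each edge is present independently with probability $\tfrac12$; "almost all graphs have property P" means that the probability that $G(n,\tfrac12)$ has P tends to $1$ as $n\to\infty$. -}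

module Defs where

open import Data.Nat using (ℕ; _<ᵇ_; _*_; _^_; _≥_; _<_)
open import Data.Nat.Combinatorics using (_C_)
open import Data.Fin using (Fin; toℕ)
open import Data.Bool using (Bool; true; false; if_then_else_)
open import Data.List using (List; length)
open import Data.List.Membership.Propositional using (_∈_)
open import Data.Product using (Σ; ∃; _×_; _,_)
open import Data.Fin.Permutation using (Permutation′; _⟨$⟩ʳ_)
open import Relation.Binary.PropositionalEquality using (_≡_; _≢_)

record Graph (n : ℕ) : Set where
  field
    adj  : Fin n → Fin n → Bool
    sym  : ∀ i j → adj i j ≡ adj j i
    irr  : ∀ i → adj i i ≡ false
open Graph public

_≋_ : ∀ {n} → Graph n → Graph n → Set
G ≋ H = ∀ i j → adj G i j ≡ adj H i j

-- Alphabet Σ = Fin m; a word of length n is w : Fin n → Fin m;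
-- a decoder is D ⊆ Σ², given as D : Fin m → Fin m → Bool.
letterAdj : ∀ {n m} → (Fin m → Fin m → Bool) → (Fin n → Fin m) → Fin n → Fin n → Bool
letterAdj D w i j =
  if toℕ i <ᵇ toℕ j then D (w i) (w j)
  else (if toℕ j <ᵇ toℕ i then D (w j) (w i) else false)

LetterGraphIso : ∀ {n m} → (Fin m → Fin m → Bool) → (Fin n → Fin m) → Graph n → Set
LetterGraphIso D w G =
  Σ (Permutation′ _) λ π → ∀ u v → adj G u v ≡ letterAdj D w (π ⟨$⟩ʳ u) (π ⟨$⟩ʳ v)

HasTripleLetter : ∀ {n} → Graph n → Set
HasTripleLetter {n} G =
  Σ ℕ λ m → Σ (Fin n → Fin m) λ w → Σ (Fin m → Fin m → Bool) λ D →
    LetterGraphIso D w G ×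
    (Σ (Fin n) λ i → Σ (Fin n) λ j → Σ (Fin n) λ k →
       i ≢ j × j ≢ k × i ≢ k × w i ≡ w j × w j ≡ w k)

-- "The probability that G(n,1/2) has P is < 1/k": the set of labeled graphs on
-- Fin n having P is covered by a list of graphs of size less than 2^(n C 2)/k.
-- (There are exactly 2^(n C 2) labeled graphs on Fin n.)
ProbBelow : (∀ {n} → Graph n → Set) → ℕ → ℕ → Set
ProbBelow P k n =
  Σ (List (Graph n)) λ L →
    (∀ G → P G → Σ (Graph n) λ H → H ∈ L × G ≋ H) ×
    (k * length L < 2 ^ (n C 2))

AlmostNo : (∀ {n} → Graph n → Set) → Set
AlmostNo P = ∀ k → Σ ℕ λ N → ∀ n → n ≥ N → ProbBelow P k n

-- If one letter occurs at positions x < y < z of w, then every vertex before y sees y as it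
-- sees z, and every vertex after y sees y as it sees x.  So a graph with a triple letter has
-- distinct vertices a, b, c such that every other vertex is adjacent to b exactly when it is
-- adjacent to a, or exactly when it is adjacent to c: only 6 of the 8 adjacency patterns
-- towards {a, b, c} can occur.  Fixing the triple and adding the other n − 3 vertices one at a
-- time shows that at most 2^(n choose 2) · (3/4)^(n − 3) graphs have this property, so at most
-- n³ · 2^(n choose 2) · (3/4)^(n − 3) graphs have some such triple, and n³ (3/4)^n → 0.

module Submission where

open import Data.Bool using (Bool; true; false)
open import Data.Bool.Properties using () renaming (_≟_ to _≟ᵇ_)
open import Data.Empty using (⊥-elim)
open import Data.Fin using (Fin; zero; suc; toℕ; _↑ʳ_)
open import Data.Fin.Patterns using (0F; 1F; 2F)
open import Data.Fin.Permutation
  using (Permutation′; _⟨$⟩ʳ_; _⟨$⟩ˡ_; inverseˡ; inverseʳ; transpose; _∘ₚ_) renaming (id to idₚ)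
import Data.Fin.Permutation.Components as PC
import Data.Fin.Properties as Fin
open import Data.List using (List; []; _∷_; [_]; length; map; filter; allFin; cartesianProduct; cartesianProductWith)
open import Data.List.Membership.Propositional using (_∈_)
open import Data.List.Membership.Propositional.Properties
  using (∈-allFin; ∈-filter⁺; ∈-cartesianProductWith⁺; ∈-cartesianProduct⁺)
open import Data.List.Properties using (length-++; length-map; length-tabulate)
open import Data.List.Relation.Unary.Any using (here; there)
open import Data.Nat using (ℕ; zero; suc; _+_; _*_; _^_; _∸_; _≤_; _<_; _<ᵇ_; z<s)
open import Data.Nat.Combinatorics using (_C_; nCk+nC[k+1]≡[n+1]C[k+1]; nC1≡n)
open import Data.Nat.Properties
open import Algebra.Properties.CommutativeSemigroup *-commutativeSemigroup using (x∙yz≈y∙xz)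
open import Data.Nat.Tactic.RingSolver using (solve-∀)
open import Data.Product using (Σ; _×_; _,_)
open import Data.Sum using (_⊎_; inj₁; inj₂)
open import Data.Unit using (⊤; tt)
open import Data.Vec.Functional using (Vector; head; tail) renaming (_∷_ to _◂_)
open import Function using (_∘_; id)
open import Function.Definitions using (Injective)
open import Relation.Binary.Definitions using (tri<; tri≈; tri>)
open import Relation.Binary.PropositionalEquality
  using (_≡_; _≢_; _≗_; refl; sym; trans; cong; cong₂; subst; module ≡-Reasoning)
open import Relation.Nullary using (Dec)
open import Relation.Nullary.Decidable using (_⊎-dec_; dec-true; dec-false)

open import Defs hiding (sym)

private
  variable
    A B R : Set
    n : ℕ

Covers : (A → A → Set) → List A → (A → Set) → Set
Covers {A} _≈_ L P = ∀ x → P x → Σ A λ y → y ∈ L × x ≈ y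

length-cartesianProductWith : ∀ (f : A → B → R) xs ys →
  length (cartesianProductWith f xs ys) ≡ length xs * length ys
length-cartesianProductWith f [] ys = refl
length-cartesianProductWith f (x ∷ xs) ys = trans (length-++ (map (f x) ys))
  (cong₂ _+_ (length-map (f x) ys) (length-cartesianProductWith f xs ys))

extendVectors : List (Vector Bool n) → List (Vector Bool (suc n))
extendVectors = cartesianProductWith _◂_ (false ∷ true ∷ [])

∈-bools : ∀ b → b ∈ false ∷ true ∷ []
∈-bools false = here refl
∈-bools true  = there (here refl)

extendVectors-covers : ∀ {F : List (Vector Bool n)} {P : Vector Bool n → Set} →
  Covers _≗_ F P → Covers _≗_ (extendVectors F) (P ∘ tail)
extendVectors-covers cover f Pf with cover (tail f) Pf
... | g , g∈F , tail-f≗g = head f ◂ g , ∈-cartesianProductWith⁺ _◂_ (∈-bools (head f)) g∈F , f≗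
  where
  f≗ : f ≗ head f ◂ g
  f≗ zero    = refl
  f≗ (suc i) = tail-f≗g i

length-extendVectors : (F : List (Vector Bool n)) → length (extendVectors F) ≡ 2 * length F
length-extendVectors = length-cartesianProductWith _◂_ (false ∷ true ∷ [])

allVectors : ∀ n → List (Vector Bool n)
allVectors zero    = [ (λ ()) ]
allVectors (suc n) = extendVectors (allVectors n)

allVectors-covers : ∀ n → Covers _≗_ (allVectors n) (λ _ → ⊤)
allVectors-covers zero    f _ = _ , here refl , λ ()
allVectors-covers (suc n) = extendVectors-covers (allVectors-covers n)

addVertex : Graph n → Vector Bool n → Graph (suc n)
addVertex {n} G f = record { adj = a ; sym = a-sym ; irr = a-irr }
  where
  a : Fin (suc n) → Fin (suc n) → Bool
  a zero    zero    = false
  a zero    (suc j) = f j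
  a (suc i) zero    = f i
  a (suc i) (suc j) = adj G i j
  a-sym : ∀ i j → a i j ≡ a j i
  a-sym zero    zero    = refl
  a-sym zero    (suc j) = refl
  a-sym (suc i) zero    = refl
  a-sym (suc i) (suc j) = Graph.sym G i j
  a-irr : ∀ i → a i i ≡ false
  a-irr zero    = refl
  a-irr (suc i) = irr G i

comap : ∀ {m} → (Fin m → Fin n) → Graph n → Graph m
comap f G = record
  { adj = λ i j → adj G (f i) (f j)
  ; sym = λ i j → Graph.sym G (f i) (f j)
  ; irr = λ i → irr G (f i)
  }

addVertex-cong : {G H : Graph n} {f g : Vector Bool n} →
  G ≋ H → f ≗ g → addVertex G f ≋ addVertex H g
addVertex-cong G≋H f≗g zero    zero    = refl
addVertex-cong G≋H f≗g zero    (suc j) = f≗g j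
addVertex-cong G≋H f≗g (suc i) zero    = f≗g i
addVertex-cong G≋H f≗g (suc i) (suc j) = G≋H i j

addVertex-split : (G : Graph (suc n)) → G ≋ addVertex (comap suc G) (adj G zero ∘ suc)
addVertex-split G zero    zero    = irr G zero
addVertex-split G zero    (suc j) = refl
addVertex-split G (suc i) zero    = Graph.sym G (suc i) zero
addVertex-split G (suc i) (suc j) = refl

extendGraphs : List (Graph n) → List (Vector Bool n) → List (Graph (suc n))
extendGraphs = cartesianProductWith addVertex

extendGraphs-covers : ∀ {L : List (Graph n)} {F} {P : Graph n → Set} {Q : Vector Bool n → Set} →
  Covers _≋_ L P → Covers _≗_ F Q →
  Covers _≋_ (extendGraphs L F) (λ G → P (comap suc G) × Q (adj G zero ∘ suc))
extendGraphs-covers coverL coverF G (P-rest , Q-nbrs)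
  with coverL (comap suc G) P-rest | coverF (adj G zero ∘ suc) Q-nbrs
... | H , H∈L , rest≋H | g , g∈F , nbrs≗g =
  addVertex H g , ∈-cartesianProductWith⁺ addVertex H∈L g∈F ,
  λ i j → trans (addVertex-split G i j) (addVertex-cong rest≋H nbrs≗g i j)

allGraphs : ∀ n → List (Graph n)
allGraphs zero    = [ record { adj = λ () ; sym = λ () ; irr = λ () } ]
allGraphs (suc n) = extendGraphs (allGraphs n) (allVectors n)

allGraphs-covers : ∀ n → Covers _≋_ (allGraphs n) (λ _ → ⊤)
allGraphs-covers zero    G _ = _ , here refl , λ ()
allGraphs-covers (suc n) G _ =
  extendGraphs-covers (allGraphs-covers n) (allVectors-covers n) G (tt , tt)

transpose-matchˡ : (i j : Fin n) → PC.transpose i j i ≡ j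
transpose-matchˡ i j rewrite dec-true (i Fin.≟ i) refl = refl

transpose-fixes : {i j k : Fin n} → k ≢ i → k ≢ j → PC.transpose i j k ≡ k
transpose-fixes {i = i} {j} {k} k≢i k≢j
  rewrite dec-false (k Fin.≟ i) k≢i | dec-false (k Fin.≟ j) k≢j = refl

⟨$⟩ʳ-injective : (π : Permutation′ n) → Injective _≡_ _≡_ (π ⟨$⟩ʳ_)
⟨$⟩ʳ-injective π πi≡πj = trans (sym (inverseˡ π)) (trans (cong (π ⟨$⟩ˡ_) πi≡πj) (inverseˡ π))

⟨$⟩ˡ-injective : (π : Permutation′ n) → Injective _≡_ _≡_ (π ⟨$⟩ˡ_)
⟨$⟩ˡ-injective π π⁻¹i≡π⁻¹j = trans (sym (inverseʳ π)) (trans (cong (π ⟨$⟩ʳ_) π⁻¹i≡π⁻¹j) (inverseʳ π))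

redirect : Permutation′ n → Fin n → Fin n → Permutation′ n
redirect π x a = π ∘ₚ transpose (π ⟨$⟩ʳ x) a

redirect-sends : (π : Permutation′ n) (x a : Fin n) → redirect π x a ⟨$⟩ʳ x ≡ a
redirect-sends π x a = transpose-matchˡ (π ⟨$⟩ʳ x) a

redirect-keeps : (π : Permutation′ n) {x a k : Fin n} →
  k ≢ x → π ⟨$⟩ʳ k ≢ a → redirect π x a ⟨$⟩ʳ k ≡ π ⟨$⟩ʳ k
redirect-keeps π k≢x πk≢a = transpose-fixes (k≢x ∘ ⟨$⟩ʳ-injective π) πk≢a

Distinct : Fin n → Fin n → Fin n → Set
Distinct a b c = a ≢ b × b ≢ c × a ≢ c

moveTriple : (x y z a b c : Fin n) → Permutation′ n
moveTriple x y z a b c = redirect (redirect (redirect idₚ x a) y b) z c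

moveTriple-sends : ∀ {x y z a b c : Fin n} → Distinct x y z → Distinct a b c →
  let π = moveTriple x y z a b c in π ⟨$⟩ʳ x ≡ a × π ⟨$⟩ʳ y ≡ b × π ⟨$⟩ʳ z ≡ c
moveTriple-sends {x = x} {y} {z} {a} {b} {c} (x≢y , y≢z , x≢z) (a≢b , b≢c , a≢c) =
  trans (redirect-keeps π₂ x≢z (a≢c ∘ trans (sym π₂x))) π₂x ,
  trans (redirect-keeps π₂ y≢z (b≢c ∘ trans (sym π₂y))) π₂y ,
  redirect-sends π₂ z c
  where
  π₁ = redirect idₚ x a
  π₂ = redirect π₁ y b
  π₁x : π₁ ⟨$⟩ʳ x ≡ a
  π₁x = redirect-sends idₚ x a
  π₂x : π₂ ⟨$⟩ʳ x ≡ a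
  π₂x = trans (redirect-keeps π₁ x≢y (a≢b ∘ trans (sym π₁x))) π₁x
  π₂y : π₂ ⟨$⟩ʳ y ≡ b
  π₂y = redirect-sends π₁ y b

Splits : Vector Bool n → Fin n → Fin n → Fin n → Set
Splits f a b c = f b ≡ f a ⊎ f b ≡ f c

splits? : ∀ (f : Vector Bool n) a b c → Dec (Splits f a b c)
splits? f a b c = (f b ≟ᵇ f a) ⊎-dec (f b ≟ᵇ f c)

Splits-resp : ∀ {f g : Vector Bool n} {a b c} → f ≗ g → Splits g a b c → Splits f a b c
Splits-resp {a = a} {b} {c} f≗g (inj₁ gb≡ga) = inj₁ (trans (f≗g b) (trans gb≡ga (sym (f≗g a))))
Splits-resp {a = a} {b} {c} f≗g (inj₂ gb≡gc) = inj₂ (trans (f≗g b) (trans gb≡gc (sym (f≗g c))))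

Sandwich : (Fin n → Fin n → Bool) → Fin n → Fin n → Fin n → Set
Sandwich {n} A a b c = ∀ u → u ≢ a → u ≢ b → u ≢ c → Splits (A u) a b c

Sandwich-resp : ∀ {A B : Fin n → Fin n → Bool} {a b c} →
  (∀ i j → A i j ≡ B i j) → Sandwich B a b c → Sandwich A a b c
Sandwich-resp A≡B s u u≢a u≢b u≢c = Splits-resp (A≡B u) (s u u≢a u≢b u≢c)

Sandwich-pullback : ∀ {m} {A : Fin n → Fin n → Bool} {f : Fin m → Fin n} {x y z a b c} →
  Injective _≡_ _≡_ f → f x ≡ a → f y ≡ b → f z ≡ c →
  Sandwich A a b c → Sandwich (λ i j → A (f i) (f j)) x y z
Sandwich-pullback {f = f} f-inj refl refl refl s u u≢x u≢y u≢z =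
  s (f u) (u≢x ∘ f-inj) (u≢y ∘ f-inj) (u≢z ∘ f-inj)

HasSandwich : Graph n → Set
HasSandwich {n} G =
  Σ (Fin n) λ a → Σ (Fin n) λ b → Σ (Fin n) λ c → Distinct a b c × Sandwich (adj G) a b c

letterAdj-< : ∀ {m} (D : Fin m → Fin m → Bool) (w : Fin n → Fin m) {i j} →
  toℕ i < toℕ j → letterAdj D w i j ≡ D (w i) (w j)
letterAdj-< D w {i} {j} i<j with toℕ i <ᵇ toℕ j | <⇒<ᵇ i<j
... | true | _ = refl

letterAdj-> : ∀ {m} (D : Fin m → Fin m → Bool) (w : Fin n → Fin m) {i j} →
  toℕ j < toℕ i → letterAdj D w i j ≡ D (w j) (w i)
letterAdj-> D w {i} {j} j<i with toℕ i <ᵇ toℕ j | <ᵇ⇒< (toℕ i) (toℕ j)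
... | true  | i<j = ⊥-elim (<-asym j<i (i<j _))
... | false | _ with toℕ j <ᵇ toℕ i | <⇒<ᵇ j<i
...   | true | _ = refl

letterAdj-sandwich : ∀ {m} (D : Fin m → Fin m → Bool) (w : Fin n → Fin m) {x y z} →
  toℕ x < toℕ y → toℕ y < toℕ z → w x ≡ w y → w y ≡ w z → Sandwich (letterAdj D w) x y z
letterAdj-sandwich D w {x} {y} {z} x<y y<z wx≡wy wy≡wz r _ r≢y _ with Fin.<-cmp r y
... | tri< r<y _ _ = inj₂ (begin
  letterAdj D w r y  ≡⟨ letterAdj-< D w r<y ⟩
  D (w r) (w y)      ≡⟨ cong (D (w r)) wy≡wz ⟩
  D (w r) (w z)      ≡⟨ letterAdj-< D w (<-trans r<y y<z) ⟨
  letterAdj D w r z  ∎)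
  where open ≡-Reasoning
... | tri≈ _ r≡y _ = ⊥-elim (r≢y r≡y)
... | tri> _ _ y<r = inj₁ (begin
  letterAdj D w r y  ≡⟨ letterAdj-> D w y<r ⟩
  D (w y) (w r)      ≡⟨ cong (λ ℓ → D ℓ (w r)) wx≡wy ⟨
  D (w x) (w r)      ≡⟨ letterAdj-> D w (<-trans x<y y<r) ⟨
  letterAdj D w r x  ∎)
  where open ≡-Reasoning

SortedTriple : (Fin n → Set) → Set
SortedTriple {n} Q =
  Σ (Fin n) λ x → Σ (Fin n) λ y → Σ (Fin n) λ z → toℕ x < toℕ y × toℕ y < toℕ z × Q x × Q y × Q z

insert-sorted : ∀ {Q : Fin n → Set} {i j k} →
  toℕ i < toℕ j → Q i → Q j → k ≢ i → k ≢ j → Q k → SortedTriple Q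
insert-sorted {i = i} {j} {k} i<j Qi Qj k≢i k≢j Qk with Fin.<-cmp k i | Fin.<-cmp k j
... | tri< k<i _ _ | _              = k , i , j , k<i , i<j , Qk , Qi , Qj
... | tri≈ _ k≡i _ | _              = ⊥-elim (k≢i k≡i)
... | tri> _ _ i<k | tri< k<j _ _   = i , k , j , i<k , k<j , Qi , Qk , Qj
... | tri> _ _ _   | tri≈ _ k≡j _   = ⊥-elim (k≢j k≡j)
... | tri> _ _ _   | tri> _ _ j<k   = i , j , k , i<j , j<k , Qi , Qj , Qk

sort-distinct : ∀ {Q : Fin n → Set} {i j k} → Distinct i j k → Q i → Q j → Q k → SortedTriple Q
sort-distinct {i = i} {j} (i≢j , j≢k , i≢k) Qi Qj Qk with Fin.<-cmp i j
... | tri< i<j _ _ = insert-sorted i<j Qi Qj (i≢k ∘ sym) (j≢k ∘ sym) Qk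
... | tri≈ _ i≡j _ = ⊥-elim (i≢j i≡j)
... | tri> _ _ j<i = insert-sorted j<i Qj Qi (j≢k ∘ sym) (i≢k ∘ sym) Qk

tripleLetter⇒sandwich : {G : Graph n} → HasTripleLetter G → HasSandwich G
tripleLetter⇒sandwich (_ , w , D , (π , G≡Γ) , i , j , k , i≢j , j≢k , i≢k , wi≡wj , wj≡wk) =
  let x , y , z , x<y , y<z , wx , wy , wz =
        sort-distinct {Q = λ p → w p ≡ w j} (i≢j , j≢k , i≢k) wi≡wj refl (sym wj≡wk)
  in π ⟨$⟩ˡ x , π ⟨$⟩ˡ y , π ⟨$⟩ˡ z ,
     ( Fin.<⇒≢ x<y ∘ ⟨$⟩ˡ-injective π
     , Fin.<⇒≢ y<z ∘ ⟨$⟩ˡ-injective π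
     , Fin.<⇒≢ (<-trans x<y y<z) ∘ ⟨$⟩ˡ-injective π) ,
     Sandwich-resp G≡Γ
       (Sandwich-pullback {A = letterAdj D w} (⟨$⟩ʳ-injective π) (inverseʳ π) (inverseʳ π) (inverseʳ π)
         (letterAdj-sandwich D w x<y y<z (trans wx (sym wy)) (trans wy (sym wz))))

-- addVertex inserts the new vertex at index zero, so the corners m ↑ʳ 0F, 1F, 2F are the
-- three vertices present from the start, and the recursion on m bottoms out in Graph 3.
SplitsAtCorners : ∀ m → Vector Bool (m + 3) → Set
SplitsAtCorners m f = Splits f (m ↑ʳ 0F) (m ↑ʳ 1F) (m ↑ʳ 2F)

SandwichAtCorners : ∀ m → Graph (m + 3) → Set
SandwichAtCorners m G = Sandwich (adj G) (m ↑ʳ 0F) (m ↑ʳ 1F) (m ↑ʳ 2F)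

splitVectors : ∀ m → List (Vector Bool (m + 3))
splitVectors zero    = filter (λ f → splits? f 0F 1F 2F) (allVectors 3)
splitVectors (suc m) = extendVectors (splitVectors m)

splitVectors-covers : ∀ m → Covers _≗_ (splitVectors m) (SplitsAtCorners m)
splitVectors-covers zero f f-splits with allVectors-covers 3 f tt
... | g , g∈all , f≗g =
  g , ∈-filter⁺ (λ f → splits? f 0F 1F 2F) g∈all (Splits-resp (sym ∘ f≗g) f-splits) , f≗g
splitVectors-covers (suc m) = extendVectors-covers (splitVectors-covers m)

length-splitVectors : ∀ m → length (splitVectors m) ≡ 6 * 2 ^ m
length-splitVectors zero    = refl
length-splitVectors (suc m) = trans (length-extendVectors (splitVectors m))
  (trans (cong (2 *_) (length-splitVectors m)) (x∙yz≈y∙xz 2 6 (2 ^ m)))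

sandwichAtCornersGraphs : ∀ m → List (Graph (m + 3))
sandwichAtCornersGraphs zero    = allGraphs 3
sandwichAtCornersGraphs (suc m) = extendGraphs (sandwichAtCornersGraphs m) (splitVectors m)

sandwichAtCornersGraphs-covers : ∀ m → Covers _≋_ (sandwichAtCornersGraphs m) (SandwichAtCorners m)
sandwichAtCornersGraphs-covers zero    G _ = allGraphs-covers 3 G tt
sandwichAtCornersGraphs-covers (suc m) G s =
  extendGraphs-covers (sandwichAtCornersGraphs-covers m) (splitVectors-covers m) G
    (Sandwich-pullback {A = adj G} Fin.suc-injective refl refl refl s , s zero (λ ()) (λ ()) (λ ()))

private
  gather-factors : ∀ l t f → l * (6 * t) * (4 * f) ≡ t * 8 * (l * f) * 3
  gather-factors = solve-∀

  move-three : ∀ t x y → t * 8 * (x * y) * 3 ≡ t * 8 * x * (3 * y)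
  move-three = solve-∀

2^n*2^[nC2]≡2^[[1+n]C2] : ∀ n → 2 ^ n * 2 ^ (n C 2) ≡ 2 ^ (suc n C 2)
2^n*2^[nC2]≡2^[[1+n]C2] n = begin
  2 ^ n * 2 ^ (n C 2)        ≡⟨ cong (λ k → 2 ^ k * 2 ^ (n C 2)) (nC1≡n n) ⟨
  2 ^ (n C 1) * 2 ^ (n C 2)  ≡⟨ ^-distribˡ-+-* 2 (n C 1) (n C 2) ⟨
  2 ^ (n C 1 + n C 2)        ≡⟨ cong (2 ^_) (nCk+nC[k+1]≡[n+1]C[k+1] n 1) ⟩
  2 ^ (suc n C 2)            ∎
  where open ≡-Reasoning

length-sandwichAtCornersGraphs : ∀ m →
  length (sandwichAtCornersGraphs m) * 4 ^ m ≡ 2 ^ ((m + 3) C 2) * 3 ^ m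
length-sandwichAtCornersGraphs zero    = refl
length-sandwichAtCornersGraphs (suc m) = begin
  length (extendGraphs S (splitVectors m)) * (4 * 4 ^ m)
    ≡⟨ cong (_* (4 * 4 ^ m)) (trans (length-cartesianProductWith addVertex S (splitVectors m))
                                    (cong (length S *_) (length-splitVectors m))) ⟩
  length S * (6 * 2 ^ m) * (4 * 4 ^ m)  ≡⟨ gather-factors (length S) (2 ^ m) (4 ^ m) ⟩
  2 ^ m * 8 * (length S * 4 ^ m) * 3    ≡⟨ cong (λ x → 2 ^ m * 8 * x * 3) (length-sandwichAtCornersGraphs m) ⟩
  2 ^ m * 8 * (P * 3 ^ m) * 3           ≡⟨ move-three (2 ^ m) P (3 ^ m) ⟩
  2 ^ m * 2 ^ 3 * P * (3 * 3 ^ m)       ≡⟨ cong (λ x → x * P * (3 * 3 ^ m)) (^-distribˡ-+-* 2 m 3) ⟨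
  2 ^ (m + 3) * P * (3 * 3 ^ m)         ≡⟨ cong (_* (3 * 3 ^ m)) (2^n*2^[nC2]≡2^[[1+n]C2] (m + 3)) ⟩
  2 ^ (suc (m + 3) C 2) * (3 * 3 ^ m)   ∎
  where
  open ≡-Reasoning
  S = sandwichAtCornersGraphs m
  P = 2 ^ ((m + 3) C 2)

triples : ∀ n → List (Fin n × Fin n × Fin n)
triples n = cartesianProduct (allFin n) (cartesianProduct (allFin n) (allFin n))

∈-triples : (a b c : Fin n) → (a , b , c) ∈ triples n
∈-triples a b c = ∈-cartesianProduct⁺ (∈-allFin a) (∈-cartesianProduct⁺ (∈-allFin b) (∈-allFin c))

length-triples : ∀ n → length (triples n) ≡ n * (n * n)
length-triples n = begin
  length (triples n)
    ≡⟨ length-cartesianProductWith _,_ (allFin n) (cartesianProduct (allFin n) (allFin n)) ⟩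
  length (allFin n) * length (cartesianProduct (allFin n) (allFin n))
    ≡⟨ cong (length (allFin n) *_) (length-cartesianProductWith _,_ (allFin n) (allFin n)) ⟩
  length (allFin n) * (length (allFin n) * length (allFin n))
    ≡⟨ cong (λ k → k * (k * k)) (length-tabulate {n = n} id) ⟩
  n * (n * n)                             ∎
  where open ≡-Reasoning

corners-distinct : ∀ m → Distinct (m ↑ʳ 0F) (m ↑ʳ 1F) (m ↑ʳ 2F)
corners-distinct m =
  (λ ()) ∘ Fin.↑ʳ-injective {3} m 0F 1F ,
  (λ ()) ∘ Fin.↑ʳ-injective {3} m 1F 2F ,
  (λ ()) ∘ Fin.↑ʳ-injective {3} m 0F 2F

fromCorners : ∀ m → Fin (m + 3) × Fin (m + 3) × Fin (m + 3) → Permutation′ (m + 3)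
fromCorners m (a , b , c) = moveTriple (m ↑ʳ 0F) (m ↑ʳ 1F) (m ↑ʳ 2F) a b c

-- A triple that is not distinct yields a meaningless relabelling; it only lengthens the list.
relabelFromCorners : ∀ m → Fin (m + 3) × Fin (m + 3) × Fin (m + 3) → Graph (m + 3) → Graph (m + 3)
relabelFromCorners m t = comap (fromCorners m t ⟨$⟩ˡ_)

sandwichGraphs : ∀ m → List (Graph (m + 3))
sandwichGraphs m = cartesianProductWith (relabelFromCorners m) (triples (m + 3)) (sandwichAtCornersGraphs m)

sandwichGraphs-covers : ∀ m → Covers _≋_ (sandwichGraphs m) HasSandwich
sandwichGraphs-covers m G (a , b , c , abc , s) =
  let πx≡a , πy≡b , πz≡c = moveTriple-sends (corners-distinct m) abc
      H , H∈ , πG≋H = sandwichAtCornersGraphs-covers m (comap (π ⟨$⟩ʳ_) G)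
                        (Sandwich-pullback {A = adj G} (⟨$⟩ʳ-injective π) πx≡a πy≡b πz≡c s)
  in comap (π ⟨$⟩ˡ_) H ,
     ∈-cartesianProductWith⁺ (relabelFromCorners m) (∈-triples a b c) H∈ ,
     λ i j → trans (sym (cong₂ (adj G) (inverseʳ π {i}) (inverseʳ π {j}))) (πG≋H (π ⟨$⟩ˡ i) (π ⟨$⟩ˡ j))
  where π = fromCorners m (a , b , c)

length-sandwichGraphs : ∀ m →
  length (sandwichGraphs m) ≡ (m + 3) * ((m + 3) * (m + 3)) * length (sandwichAtCornersGraphs m)
length-sandwichGraphs m = trans
  (length-cartesianProductWith (relabelFromCorners m) (triples (m + 3)) (sandwichAtCornersGraphs m))
  (cong (_* length (sandwichAtCornersGraphs m)) (length-triples (m + 3)))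

private
  -- 3 (15 + d)^4 ≤ 4 (14 + d)^4, moved around so that no subtraction occurs.
  ratio-identity : ∀ d →
    4 * ((14 + d) * ((14 + d) * ((14 + d) * ((14 + d) * 1))))
      ≡ 3 * ((15 + d) * ((15 + d) * ((15 + d) * ((15 + d) * 1))))
        + (d * d * d * d + 44 * (d * d * d) + 654 * (d * d) + 3404 * d + 1789)
  ratio-identity = solve-∀

  absorb-factor : ∀ x c y → x * (c * (x * (x * (x * 1))) * y) ≡ c * (x * (x * (x * (x * 1))) * y)
  absorb-factor = solve-∀

3*[15+d]^4≤4*[14+d]^4 : ∀ d → 3 * (15 + d) ^ 4 ≤ 4 * (14 + d) ^ 4
3*[15+d]^4≤4*[14+d]^4 d = ≤-trans (m≤m+n _ _) (≤-reflexive (sym (ratio-identity d)))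

[14+d]^4*3^d≤14^4*4^d : ∀ d → (14 + d) ^ 4 * 3 ^ d ≤ 14 ^ 4 * 4 ^ d
[14+d]^4*3^d≤14^4*4^d zero = ≤-refl
[14+d]^4*3^d≤14^4*4^d (suc d) = begin
    (15 + d) ^ 4 * (3 * 3 ^ d)  ≡⟨ x∙yz≈y∙xz ((15 + d) ^ 4) 3 (3 ^ d) ⟩
    3 * ((15 + d) ^ 4 * 3 ^ d)  ≡⟨ *-assoc 3 ((15 + d) ^ 4) (3 ^ d) ⟨
    3 * (15 + d) ^ 4 * 3 ^ d    ≤⟨ *-monoˡ-≤ (3 ^ d) (3*[15+d]^4≤4*[14+d]^4 d) ⟩
    4 * (14 + d) ^ 4 * 3 ^ d    ≡⟨ *-assoc 4 ((14 + d) ^ 4) (3 ^ d) ⟩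
    4 * ((14 + d) ^ 4 * 3 ^ d)  ≤⟨ *-monoʳ-≤ 4 ([14+d]^4*3^d≤14^4*4^d d) ⟩
    4 * (14 ^ 4 * 4 ^ d)        ≡⟨ x∙yz≈y∙xz 4 (14 ^ 4) (4 ^ d) ⟩
    14 ^ 4 * (4 * 4 ^ d)        ∎
  where open ≤-Reasoning

c*[m+3]^3*3^m<4^m-eventually : ∀ c → Σ ℕ λ M → ∀ m → M ≤ m → c * (m + 3) ^ 3 * 3 ^ m < 4 ^ m
c*[m+3]^3*3^m<4^m-eventually c = c * 14 ^ 4 , bound
  where
  bound : ∀ m → c * 14 ^ 4 ≤ m → c * (m + 3) ^ 3 * 3 ^ m < 4 ^ m
  bound m M≤m = *-cancelˡ-< (14 + m) _ _ (begin-strict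
    (14 + m) * (c * (m + 3) ^ 3 * 3 ^ m)
      ≤⟨ *-monoʳ-≤ (14 + m) (*-monoˡ-≤ (3 ^ m) (*-monoʳ-≤ c (^-monoˡ-≤ 3 m+3≤14+m))) ⟩
    (14 + m) * (c * (14 + m) ^ 3 * 3 ^ m)  ≡⟨ absorb-factor (14 + m) c (3 ^ m) ⟩
    c * ((14 + m) ^ 4 * 3 ^ m)             ≤⟨ *-monoʳ-≤ c ([14+d]^4*3^d≤14^4*4^d m) ⟩
    c * (14 ^ 4 * 4 ^ m)                   ≡⟨ *-assoc c (14 ^ 4) (4 ^ m) ⟨
    c * 14 ^ 4 * 4 ^ m                     <⟨ *-monoˡ-< (4 ^ m) {{m^n≢0 4 m}} (≤-<-trans M≤m (m<n+m m {14} z<s)) ⟩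
    (14 + m) * 4 ^ m                       ∎)
    where
    open ≤-Reasoning
    m+3≤14+m : m + 3 ≤ 14 + m
    m+3≤14+m = ≤-trans (+-monoʳ-≤ m (m≤m+n 3 11)) (≤-reflexive (+-comm m 14))

private
  regroup-count : ∀ k n l f → k * (n * (n * n) * l) * f ≡ k * (n * (n * (n * 1))) * (l * f)
  regroup-count = solve-∀

  regroup-powers : ∀ x t s → x * (t * s) ≡ x * s * t
  regroup-powers = solve-∀

few-sandwichGraphs : ∀ k m → k * (m + 3) ^ 3 * 3 ^ m < 4 ^ m →
  k * length (sandwichGraphs m) < 2 ^ ((m + 3) C 2)
few-sandwichGraphs k m dominated = *-cancelʳ-< (4 ^ m) _ _ (begin-strict
  k * length (sandwichGraphs m) * 4 ^ m
    ≡⟨ cong (λ l → k * l * 4 ^ m) (length-sandwichGraphs m) ⟩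
  k * (N * (N * N) * length S) * 4 ^ m  ≡⟨ regroup-count k N (length S) (4 ^ m) ⟩
  k * N ^ 3 * (length S * 4 ^ m)        ≡⟨ cong (k * N ^ 3 *_) (length-sandwichAtCornersGraphs m) ⟩
  k * N ^ 3 * (2 ^ (N C 2) * 3 ^ m)     ≡⟨ regroup-powers (k * N ^ 3) (2 ^ (N C 2)) (3 ^ m) ⟩
  k * N ^ 3 * 3 ^ m * 2 ^ (N C 2)       <⟨ *-monoˡ-< (2 ^ (N C 2)) {{m^n≢0 2 (N C 2)}} dominated ⟩
  4 ^ m * 2 ^ (N C 2)                   ≡⟨ *-comm (4 ^ m) (2 ^ (N C 2)) ⟩
  2 ^ (N C 2) * 4 ^ m                   ∎)
  where
  open ≤-Reasoning
  N = m + 3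
  S = sandwichAtCornersGraphs m

tripleLetter-probBelow : ∀ k m → k * (m + 3) ^ 3 * 3 ^ m < 4 ^ m → ProbBelow HasTripleLetter k (m + 3)
tripleLetter-probBelow k m dominated =
  sandwichGraphs m ,
  (λ G triple → sandwichGraphs-covers m G (tripleLetter⇒sandwich {G = G} triple)) ,
  few-sandwichGraphs k m dominated

proposition4 : AlmostNo HasTripleLetter
proposition4 k =
  let M , dominated = c*[m+3]^3*3^m<4^m-eventually k
  in M + 3 , λ n M+3≤n →
       subst (ProbBelow HasTripleLetter k) (m∸n+n≡m (m+n≤o⇒n≤o M M+3≤n))
         (tripleLetter-probBelow k (n ∸ 3) (dominated (n ∸ 3) (m+n≤o⇒m≤o∸n M M+3≤n)))
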